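{- Fix $d \geq 1$, $r \geq 2$ and $\rho,\sigma \in \mathfrak{S}(d)$, and let $\operatorname{Walk}_r(\rho,\sigma)$ be the set of $r$-tuples $W=((s_1\ t_1),\dots,(s_r\ t_r))$ of transpositions in $\mathfrak{S}(d)$ with $s_i<t_i$ and $\sigma=\rho(s_1\ t_1)\cdots(s_r\ t_r)$. For $1\le i\le r-1$ define $R_i:\operatorname{Walk}_r(\rho,\sigma)\to\operatorname{Walk}_r(\rho,\sigma)$ by replacing the consecutive pair of steps $(s_i\ t_i),(s_{i+1}\ t_{i+1})$ in positions $i,i+1$ by the pair $\tau,\tau'$ (in positions $i,i+1$ respectively, all other steps unchanged), where: if $t_i<t_{i+1}$, then $\tau=(s_i\ t_i)(s_{i+1}\ t_{i+1})(s_i\ t_i)$ and $\tau'=(s_i\ t_i)$; if $t_i>t_{i+1}$, then $\tau=(s_{i+1}\ t_{i+1})$ and $\tau'=(s_{i+1}\ t_{i+1})(s_i\ t_i)(s_{i+1}\ t_{i+1})$; and if $t_i=t_{i+1}$, then $\tau=(s_i\ t_i)$ and $\tau'=(s_{i+1}\ t_{i+1})$ (i.e. $R_i$ does nothing). Then the operators $R_i$ satisfy the Coxeter relations $$R_i^2=I\ (1\le i\le r-1),\qquad R_iR_{i+1}R_i=R_{i+1}R_iR_{i+1}\ (1\le i\le r-2),\qquad R_iR_j=R_jR_i\ (|i-j|\ge 2).$$ Moreover, if $W$ is transitive, then so is $R_iW$.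
   Context: $\mathfrak{S}(d)$ is the symmetric group on $\{1,\dots,d\}$. A walk $W\in\operatorname{Walk}_r(\rho,\sigma)$ is transitive if the subgroup of $\mathfrak{S}(d)$ generated by $\rho$, $\sigma$ and the transpositions $(s_1\ t_1),\dots,(s_r\ t_r)$ acts transitively on $\{1,\dots,d\}$. In $R_i$, the step in position $i$ of the new walk has larger element $t_{i+1}$ and the step in position $i+1$ has larger element $t_i$ (the steps are swapped and the one of higher colour is conjugated by the one of lower colour). -}

module Defs where

open import Data.Nat using (ℕ; zero; suc)
open import Data.Fin using (Fin; _<_; _<?_)
open import Data.Fin.Permutation using (Permutation′; _⟨$⟩ʳ_; _∘ₚ_; flip; id; transpose)
open import Data.Product using (_×_; _,_; ∃-syntax)
open import Data.Vec using (Vec; []; _∷_)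
open import Data.Vec.Relation.Unary.All using (All)
open import Data.List using (List; _∷_)
open import Data.List.Membership.Propositional using (_∈_)
open import Relation.Nullary using (yes; no)
open import Relation.Binary.PropositionalEquality using (_≡_)

-- A step (s t) of a walk is stored as the ordered pair (s , t) of points of {1..d}
-- (represented as Fin d); a genuine step satisfies s < t.
Step : ℕ → Set
Step d = Fin d × Fin d

ValidStep : ∀ {d} → Step d → Set
ValidStep (s , t) = s < t

⟦_⟧ : ∀ {d} → Step d → Permutation′ d
⟦ s , t ⟧ = transpose s t

-- the product (s₁ t₁)(s₂ t₂)⋯(s_r t_r), as a function (rightmost factor acts first)
prodSteps : ∀ {d r} → Vec (Step d) r → Fin d → Fin d
prodSteps [] x = x
prodSteps (st ∷ w) x = ⟦ st ⟧ ⟨$⟩ʳ prodSteps w x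

IsWalk : ∀ {d r} → Permutation′ d → Permutation′ d → Vec (Step d) r → Set
IsWalk ρ σ W = All ValidStep W × (∀ x → σ ⟨$⟩ʳ x ≡ ρ ⟨$⟩ʳ prodSteps W x)

mkStep : ∀ {d} → Fin d → Fin d → Step d
mkStep x y with x <? y
... | yes _ = (x , y)
... | no _ = (y , x)

conj : ∀ {d} → Step d → Step d → Step d
conj (a , b) (c , e) = mkStep (transpose a b ⟨$⟩ʳ c) (transpose a b ⟨$⟩ʳ e)

swapPair : ∀ {d} → Step d → Step d → Step d × Step d
swapPair (s , t) (s' , t') with t <? t' | t' <? t
... | yes _ | _ = (conj (s , t) (s' , t') , (s , t))
... | no _ | yes _ = ((s' , t') , conj (s' , t') (s , t))
... | no _ | no _ = ((s , t) , (s' , t'))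

-- R acting at 0-based position k (positions k, k+1)
R₀ : ∀ {d r} → ℕ → Vec (Step d) r → Vec (Step d) r
R₀ zero (x ∷ y ∷ w) with swapPair x y
... | (a , b) = a ∷ b ∷ w
R₀ (suc k) (x ∷ w) = x ∷ R₀ k w
R₀ _ w = w

-- R_i with the paper's 1-based index i (1 ≤ i ≤ r-1)
R : ∀ {d r} → ℕ → Vec (Step d) r → Vec (Step d) r
R zero w = w
R (suc k) w = R₀ k w

data InSubgroup {d} (gens : List (Permutation′ d)) : Permutation′ d → Set where
  gen : ∀ {g} → g ∈ gens → InSubgroup gens g
  one : InSubgroup gens id
  mul : ∀ {g h} → InSubgroup gens g → InSubgroup gens h → InSubgroup gens (g ∘ₚ h)
  inv : ∀ {g} → InSubgroup gens g → InSubgroup gens (flip g)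

stepPerms : ∀ {d r} → Vec (Step d) r → List (Permutation′ d)
stepPerms [] = List.[]
stepPerms (st ∷ w) = ⟦ st ⟧ ∷ stepPerms w

Transitive : ∀ {d r} → Permutation′ d → Permutation′ d → Vec (Step d) r → Set
Transitive {d} ρ σ W =
  ∀ (x y : Fin d) → ∃[ g ] (InSubgroup (ρ ∷ σ ∷ stepPerms W) g × g ⟨$⟩ʳ x ≡ y)

module Submission where

-- Write X ▷ Y for the conjugate of the step Y by the step X (conj X Y) and call the
-- larger element t of a step (s t) its colour. On two adjacent steps X, Y, R acts as the
-- Hurwitz move (X, Y) ↦ (X ▷ Y, X) when X has the smaller colour, as its inverse
-- (X, Y) ↦ (Y, Y ▷ X) when Y has, and trivially on equal colours; conjugating by a step
-- of smaller colour keeps the colour. Both moves preserve the product and the generated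
-- subgroup, and each undoes the other, giving R_i² = I; far-apart R_i commute because
-- they act on disjoint positions. For the braid relation, the colours of three steps
-- are compared in all thirteen possible orders; in each case the two sides agree by
-- self-distributivity X ▷ (Y ▷ Z) = (X ▷ Y) ▷ (X ▷ Z) and involutivity X ▷ (X ▷ Y) = Y.

open import Defs
open import Data.Nat using (ℕ; zero; suc; _≤_; _+_; _∸_; s≤s)
open import Data.Nat.Properties using (+-comm; m≤o∸n⇒m+n≤o)
open import Data.Fin using (Fin; _<_; _<?_)
open import Data.Fin.Properties using (_≟_; <-cmp; <-trans; <-asym; <⇒≢)
open import Data.Fin.Permutation as P using (Permutation′; _⟨$⟩ʳ_; _⟨$⟩ˡ_; _∘ₚ_; _≈_; transpose)
open import Data.Fin.Permutation.Components using (transpose-inverse) renaming (transpose to τ)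
open import Data.List using (List; _∷_)
open import Data.List.Membership.Propositional using (_∈_)
open import Data.List.Relation.Unary.Any using (here; there)
open import Data.Vec using (Vec; []; _∷_)
open import Data.Vec.Relation.Unary.All using (All; []; _∷_)
open import Data.Product using (_×_; _,_; proj₁; proj₂; ∃-syntax; uncurry)
open import Data.Bool using (true; false)
open import Function using (_∘_)
open import Function.Definitions using (Injective)
open import Relation.Binary using (Tri; tri<; tri≈; tri>)
open import Relation.Nullary using (yes; no; does; contradiction)
open import Relation.Nullary.Decidable using (dec-true; dec-false)
open import Relation.Binary.PropositionalEquality

private
  variable
    d r : ℕ

τ-left : (a b : Fin d) → τ a b a ≡ b
τ-left a b rewrite dec-true (a ≟ a) refl = refl

τ-right : (a b : Fin d) → τ a b b ≡ a
τ-right a b with b ≟ a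
... | yes b≡a = b≡a
... | no _ rewrite dec-true (b ≟ b) refl = refl

τ-other : {a b z : Fin d} → z ≢ a → z ≢ b → τ a b z ≡ z
τ-other {a = a} {b} {z} z≢a z≢b rewrite dec-false (z ≟ a) z≢a | dec-false (z ≟ b) z≢b = refl

τ-preserves : (P : Fin d → Set) {a b z : Fin d} → P a → P b → P z → P (τ a b z)
τ-preserves P {a} {b} {z} pa pb pz with does (z ≟ a)
... | true = pb
... | false with does (z ≟ b)
...   | true = pa
...   | false = pz

data Position (a b z : Fin d) : Set where
  at-left  : z ≡ a → Position a b z
  at-right : z ≡ b → Position a b z
  elsewhere : z ≢ a → z ≢ b → Position a b z

position : (a b z : Fin d) → Position a b z
position a b z with z ≟ a | z ≟ b
... | yes z≡a | _ = at-left z≡a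
... | no _ | yes z≡b = at-right z≡b
... | no z≢a | no z≢b = elsewhere z≢a z≢b

τ-comm : (a b z : Fin d) → τ a b z ≡ τ b a z
τ-comm a b z with position a b z
... | at-left refl = trans (τ-left z b) (sym (τ-right b z))
... | at-right refl = trans (τ-right a z) (sym (τ-left z a))
... | elsewhere z≢a z≢b = trans (τ-other z≢a z≢b) (sym (τ-other z≢b z≢a))

τ-involutive : (a b z : Fin d) → τ a b (τ a b z) ≡ z
τ-involutive a b z = trans (cong (τ a b) (τ-comm a b z)) (transpose-inverse a b)

τ-injective : (a b : Fin d) → Injective _≡_ _≡_ (τ a b)
τ-injective a b {x} {y} e = begin
  x                  ≡⟨ sym (τ-involutive a b x) ⟩
  τ a b (τ a b x)    ≡⟨ cong (τ a b) e ⟩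
  τ a b (τ a b y)    ≡⟨ τ-involutive a b y ⟩
  y                  ∎
  where open ≡-Reasoning

τ-natural : ∀ {m} (f : Fin d → Fin m) → Injective _≡_ _≡_ f →
  (p q z : Fin d) → τ (f p) (f q) (f z) ≡ f (τ p q z)
τ-natural f f-inj p q z with position p q z
... | at-left refl = trans (τ-left (f z) (f q)) (cong f (sym (τ-left z q)))
... | at-right refl = trans (τ-right (f p) (f z)) (cong f (sym (τ-right p z)))
... | elsewhere z≢p z≢q =
  trans (τ-other (z≢p ∘ f-inj) (z≢q ∘ f-inj)) (cong f (sym (τ-other z≢p z≢q)))

mkStep-< : {x y : Fin d} → x < y → mkStep x y ≡ (x , y)
mkStep-< {x = x} {y} x<y with x <? y
... | yes _ = refl
... | no x≮y = contradiction x<y x≮y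

mkStep-> : {x y : Fin d} → x < y → mkStep y x ≡ (x , y)
mkStep-> {x = x} {y} x<y with y <? x
... | yes y<x = contradiction y<x (<-asym x<y)
... | no _ = refl

mkStep-comm : (x y : Fin d) → mkStep x y ≡ mkStep y x
mkStep-comm x y with <-cmp x y
... | tri< x<y _ _ = trans (mkStep-< x<y) (sym (mkStep-> x<y))
... | tri≈ _ refl _ = refl
... | tri> _ _ y<x = trans (mkStep-> y<x) (sym (mkStep-< y<x))

⟦mkStep⟧ : (x y : Fin d) → ⟦ mkStep x y ⟧ ≈ transpose x y
⟦mkStep⟧ x y z with x <? y
... | yes _ = refl
... | no _ = τ-comm y x z

⟦⟧-involutive : (X : Step d) (z : Fin d) → ⟦ X ⟧ ⟨$⟩ʳ (⟦ X ⟧ ⟨$⟩ʳ z) ≡ z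
⟦⟧-involutive (a , b) = τ-involutive a b

conj-mkStep : (X : Step d) (p q : Fin d) →
  conj X (mkStep p q) ≡ mkStep (⟦ X ⟧ ⟨$⟩ʳ p) (⟦ X ⟧ ⟨$⟩ʳ q)
conj-mkStep X p q with p <? q
... | yes _ = refl
... | no _ = mkStep-comm _ _

⟦conj⟧ : (X Y : Step d) (z : Fin d) →
  ⟦ conj X Y ⟧ ⟨$⟩ʳ (⟦ X ⟧ ⟨$⟩ʳ z) ≡ ⟦ X ⟧ ⟨$⟩ʳ (⟦ Y ⟧ ⟨$⟩ʳ z)
⟦conj⟧ (a , b) (c , e) z =
  trans (⟦mkStep⟧ (τ a b c) (τ a b e) (τ a b z)) (τ-natural (τ a b) (τ-injective a b) c e z)

⟦conj⟧-conjugate : (X Y : Step d) (z : Fin d) →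
  ⟦ X ⟧ ⟨$⟩ʳ (⟦ conj X Y ⟧ ⟨$⟩ʳ (⟦ X ⟧ ⟨$⟩ʳ z)) ≡ ⟦ Y ⟧ ⟨$⟩ʳ z
⟦conj⟧-conjugate X Y z = trans (cong (⟦ X ⟧ ⟨$⟩ʳ_) (⟦conj⟧ X Y z)) (⟦⟧-involutive X (⟦ Y ⟧ ⟨$⟩ʳ z))

conj-selfDistrib : (A B C : Step d) → conj (conj A B) (conj A C) ≡ conj A (conj B C)
conj-selfDistrib A B (c , e) = begin
  conj (conj A B) (mkStep (⟦A⟧ c) (⟦A⟧ e))
    ≡⟨ conj-mkStep (conj A B) (⟦A⟧ c) (⟦A⟧ e) ⟩
  mkStep (⟦A▷B⟧ (⟦A⟧ c)) (⟦A▷B⟧ (⟦A⟧ e))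
    ≡⟨ cong₂ mkStep (⟦conj⟧ A B c) (⟦conj⟧ A B e) ⟩
  mkStep (⟦A⟧ (⟦ B ⟧ ⟨$⟩ʳ c)) (⟦A⟧ (⟦ B ⟧ ⟨$⟩ʳ e))
    ≡⟨ conj-mkStep A (⟦ B ⟧ ⟨$⟩ʳ c) (⟦ B ⟧ ⟨$⟩ʳ e) ⟨
  conj A (conj B (c , e))
    ∎
  where
  open ≡-Reasoning
  ⟦A⟧ ⟦A▷B⟧ : Fin _ → Fin _
  ⟦A⟧ = ⟦ A ⟧ ⟨$⟩ʳ_
  ⟦A▷B⟧ = ⟦ conj A B ⟧ ⟨$⟩ʳ_

conj-involutive-mkStep : (X : Step d) (p q : Fin d) → conj X (conj X (mkStep p q)) ≡ mkStep p q
conj-involutive-mkStep X p q = begin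
  conj X (conj X (mkStep p q))                ≡⟨ cong (conj X) (conj-mkStep X p q) ⟩
  conj X (mkStep (⟦X⟧ p) (⟦X⟧ q))             ≡⟨ conj-mkStep X (⟦X⟧ p) (⟦X⟧ q) ⟩
  mkStep (⟦X⟧ (⟦X⟧ p)) (⟦X⟧ (⟦X⟧ q))           ≡⟨ cong₂ mkStep (⟦⟧-involutive X p) (⟦⟧-involutive X q) ⟩
  mkStep p q                                  ∎
  where
  open ≡-Reasoning
  ⟦X⟧ : Fin _ → Fin _
  ⟦X⟧ = ⟦ X ⟧ ⟨$⟩ʳ_

conj-involutive-conj : (X Y W : Step d) → conj X (conj X (conj Y W)) ≡ conj Y W
conj-involutive-conj X Y W = conj-involutive-mkStep X (⟦ Y ⟧ ⟨$⟩ʳ proj₁ W) (⟦ Y ⟧ ⟨$⟩ʳ proj₂ W)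

conj-involutive : (X Y : Step d) → ValidStep Y → conj X (conj X Y) ≡ Y
conj-involutive X Y v = begin
  conj X (conj X Y)                              ≡⟨ cong (conj X ∘ conj X) (sym (mkStep-< v)) ⟩
  conj X (conj X (mkStep (proj₁ Y) (proj₂ Y)))   ≡⟨ conj-involutive-mkStep X (proj₁ Y) (proj₂ Y) ⟩
  mkStep (proj₁ Y) (proj₂ Y)                     ≡⟨ mkStep-< v ⟩
  Y                                              ∎
  where open ≡-Reasoning

-- The implicit arguments of cong are given explicitly: inferring them by unification
-- makes Agda unfold conj and the transpositions inside it, which is very slow.
conj-twist : (X Y Z : Step d) → ValidStep Z → conj X (conj (conj X Y) Z) ≡ conj Y (conj X Z)
conj-twist X Y Z v = begin
  conj X (conj X▷Y Z)
    ≡⟨ cong (conj X ∘ conj X▷Y) {X▷X▷Z} {Z} (conj-involutive X Z v) ⟨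
  conj X (conj X▷Y X▷X▷Z)
    ≡⟨ cong (conj X) {conj X▷Y X▷X▷Z} {conj X (conj Y X▷Z)} (conj-selfDistrib X Y X▷Z) ⟩
  conj X (conj X (conj Y X▷Z))
    ≡⟨ conj-involutive-conj X Y X▷Z ⟩
  conj Y X▷Z
    ∎
  where
  open ≡-Reasoning
  X▷Y X▷Z X▷X▷Z : Step _
  X▷Y = conj X Y
  X▷Z = conj X Z
  X▷X▷Z = conj X X▷Z

colour : Step d → Fin d
colour = proj₂

record Coloured {d : ℕ} (c : Fin d) (X : Step d) : Set where
  constructor coloured
  field
    valid : ValidStep X
    colour≡ : colour X ≡ c

conj-coloured : {x y : Fin d} {X Y : Step d} → Coloured x X → Coloured y Y → x < y → Coloured y (conj X Y)
conj-coloured {X = s , t} {Y = s′ , t′} (coloured s<t refl) (coloured s′<t′ refl) t<t′ =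
  subst (Coloured t′) (sym (trans (cong (mkStep _) t′-fixed) (mkStep-< image<t′))) (coloured image<t′ refl)
  where
  s<t′ : s < t′
  s<t′ = <-trans s<t t<t′
  t′-fixed : τ s t t′ ≡ t′
  t′-fixed = τ-other (<⇒≢ s<t′ ∘ sym) (<⇒≢ t<t′ ∘ sym)
  image<t′ : τ s t s′ < t′
  image<t′ = τ-preserves (_< t′) s<t′ t<t′ s′<t′

swapPair-< : {x y : Fin d} {X Y : Step d} → Coloured x X → Coloured y Y → x < y → swapPair X Y ≡ (conj X Y , X)
swapPair-< {X = s , t} {Y = s′ , t′} (coloured _ refl) (coloured _ refl) t<t′ with t <? t′
... | yes _ = refl
... | no t≮t′ = contradiction t<t′ t≮t′

swapPair-> : {x y : Fin d} {X Y : Step d} → Coloured x X → Coloured y Y → y < x → swapPair X Y ≡ (Y , conj Y X)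
swapPair-> {X = s , t} {Y = s′ , t′} (coloured _ refl) (coloured _ refl) t′<t with t <? t′ | t′ <? t
... | yes t<t′ | _ = contradiction t<t′ (<-asym t′<t)
... | no _ | yes _ = refl
... | no _ | no t′≮t = contradiction t′<t t′≮t

swapPair-≡ : {x : Fin d} {X Y : Step d} → Coloured x X → Coloured x Y → swapPair X Y ≡ (X , Y)
swapPair-≡ {X = s , t} {Y = s′ , t′} (coloured _ refl) (coloured _ refl) with t <? t′
... | yes t<t′ = contradiction refl (<⇒≢ t<t′)
... | no _ = refl

data SwapPair (X Y : Step d) : Step d × Step d → Set where
  ascending  : colour X < colour Y → SwapPair X Y (conj X Y , X)
  descending : colour Y < colour X → SwapPair X Y (Y , conj Y X)
  level      : colour X ≡ colour Y → SwapPair X Y (X , Y)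

swapPair-view : (X Y : Step d) → SwapPair X Y (swapPair X Y)
swapPair-view (s , t) (s′ , t′) with t <? t′ | t′ <? t
... | yes t<t′ | _ = ascending t<t′
... | no _ | yes t′<t = descending t′<t
... | no t≮t′ | no t′≮t with <-cmp t t′
...   | tri< t<t′ _ _ = contradiction t<t′ t≮t′
...   | tri≈ _ t≡t′ _ = level t≡t′
...   | tri> _ _ t′<t = contradiction t′<t t′≮t

swapPair-valid : {X Y : Step d} → ValidStep X → ValidStep Y →
  ValidStep (proj₁ (swapPair X Y)) × ValidStep (proj₂ (swapPair X Y))
swapPair-valid {X = X} {Y} vX vY with swapPair X Y | swapPair-view X Y
... | _ | ascending X<Y = Coloured.valid (conj-coloured (coloured vX refl) (coloured vY refl) X<Y) , vX
... | _ | descending Y<X = vY , Coloured.valid (conj-coloured (coloured vY refl) (coloured vX refl) Y<X)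
... | _ | level _ = vX , vY

swapPair-involutive : {X Y : Step d} → ValidStep X → ValidStep Y → uncurry swapPair (swapPair X Y) ≡ (X , Y)
swapPair-involutive {X = X} {Y} vX vY with swapPair X Y | swapPair-view X Y
... | _ | ascending X<Y =
  trans (swapPair-> (conj-coloured (coloured vX refl) (coloured vY refl) X<Y) (coloured vX refl) X<Y)
        (cong (X ,_) (conj-involutive X Y vY))
... | _ | descending Y<X =
  trans (swapPair-< (coloured vY refl) (conj-coloured (coloured vY refl) (coloured vX refl) Y<X) Y<X)
        (cong (_, Y) (conj-involutive Y X vX))
... | _ | level X≡Y = swapPair-≡ (coloured vX refl) (coloured vY (sym X≡Y))

swapPair-product : (X Y : Step d) (z : Fin d) →
  ⟦ proj₁ (swapPair X Y) ⟧ ⟨$⟩ʳ (⟦ proj₂ (swapPair X Y) ⟧ ⟨$⟩ʳ z) ≡ ⟦ X ⟧ ⟨$⟩ʳ (⟦ Y ⟧ ⟨$⟩ʳ z)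
swapPair-product X Y z with swapPair X Y | swapPair-view X Y
... | _ | ascending _ = ⟦conj⟧ X Y z
... | _ | level _ = refl
... | _ | descending _ = begin
  ⟦ Y ⟧ ⟨$⟩ʳ (⟦ conj Y X ⟧ ⟨$⟩ʳ z)
    ≡⟨ cong (λ u → ⟦ Y ⟧ ⟨$⟩ʳ (⟦ conj Y X ⟧ ⟨$⟩ʳ u)) (sym (⟦⟧-involutive Y z)) ⟩
  ⟦ Y ⟧ ⟨$⟩ʳ (⟦ conj Y X ⟧ ⟨$⟩ʳ (⟦ Y ⟧ ⟨$⟩ʳ (⟦ Y ⟧ ⟨$⟩ʳ z)))
    ≡⟨ ⟦conj⟧-conjugate Y X (⟦ Y ⟧ ⟨$⟩ʳ z) ⟩
  ⟦ X ⟧ ⟨$⟩ʳ (⟦ Y ⟧ ⟨$⟩ʳ z)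
    ∎
  where open ≡-Reasoning

-- Permutations are records of functions, so subgroup membership is taken up to _≈_.
InSubgroup≈ : List (Permutation′ d) → Permutation′ d → Set
InSubgroup≈ G g = ∃[ g′ ] (InSubgroup G g′ × g′ ≈ g)

gen≈ : {G : List (Permutation′ d)} {g : Permutation′ d} → g ∈ G → InSubgroup≈ G g
gen≈ g∈G = _ , gen g∈G , λ _ → refl

InSubgroup≈-generated : {G H : List (Permutation′ d)} → (∀ {h} → h ∈ H → InSubgroup≈ G h) →
  ∀ {g} → InSubgroup H g → InSubgroup≈ G g
InSubgroup≈-generated H⊆G (gen h∈H) = H⊆G h∈H
InSubgroup≈-generated H⊆G one = P.id , one , λ _ → refl
InSubgroup≈-generated H⊆G (mul g∈H h∈H) with InSubgroup≈-generated H⊆G g∈H | InSubgroup≈-generated H⊆G h∈H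
... | g′ , g′∈G , g′≈g | h′ , h′∈G , h′≈h = g′ ∘ₚ h′ , mul g′∈G h′∈G , λ x → trans (cong (h′ ⟨$⟩ʳ_) (g′≈g x)) (h′≈h _)
InSubgroup≈-generated H⊆G (inv {g} g∈H) with InSubgroup≈-generated H⊆G g∈H
... | g′ , g′∈G , g′≈g = P.flip g′ , inv g′∈G , λ x → begin
  g′ ⟨$⟩ˡ x                        ≡⟨ sym (P.inverseˡ g) ⟩
  g ⟨$⟩ˡ (g ⟨$⟩ʳ (g′ ⟨$⟩ˡ x))       ≡⟨ cong (g ⟨$⟩ˡ_) (sym (g′≈g _)) ⟩
  g ⟨$⟩ˡ (g′ ⟨$⟩ʳ (g′ ⟨$⟩ˡ x))      ≡⟨ cong (g ⟨$⟩ˡ_) (P.inverseʳ g′) ⟩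
  g ⟨$⟩ˡ x                         ∎
  where open ≡-Reasoning

swapPair-generators : (X Y : Step d) {G : List (Permutation′ d)} →
  InSubgroup G ⟦ proj₁ (swapPair X Y) ⟧ → InSubgroup G ⟦ proj₂ (swapPair X Y) ⟧ →
  InSubgroup≈ G ⟦ X ⟧ × InSubgroup≈ G ⟦ Y ⟧
swapPair-generators X Y P∈G Q∈G with swapPair X Y | swapPair-view X Y
... | _ | ascending _ =
  (⟦ X ⟧ , Q∈G , λ _ → refl) , (⟦ X ⟧ ∘ₚ ⟦ conj X Y ⟧ ∘ₚ ⟦ X ⟧ , mul Q∈G (mul P∈G Q∈G) , ⟦conj⟧-conjugate X Y)
... | _ | descending _ =
  (⟦ Y ⟧ ∘ₚ ⟦ conj Y X ⟧ ∘ₚ ⟦ Y ⟧ , mul P∈G (mul Q∈G P∈G) , ⟦conj⟧-conjugate Y X) , (⟦ Y ⟧ , P∈G , λ _ → refl)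
... | _ | level _ = (⟦ X ⟧ , P∈G , λ _ → refl) , (⟦ Y ⟧ , Q∈G , λ _ → refl)

R₀-valid : (k : ℕ) (W : Vec (Step d) r) → All ValidStep W → All ValidStep (R₀ k W)
R₀-valid zero [] [] = []
R₀-valid zero (_ ∷ []) vW = vW
R₀-valid zero (X ∷ Y ∷ W) (vX ∷ vY ∷ vW) with swapPair-valid vX vY
... | vP , vQ = vP ∷ vQ ∷ vW
R₀-valid (suc k) [] [] = []
R₀-valid (suc k) (X ∷ W) (vX ∷ vW) = vX ∷ R₀-valid k W vW

R₀-involutive : (k : ℕ) (W : Vec (Step d) r) → All ValidStep W → R₀ k (R₀ k W) ≡ W
R₀-involutive zero [] _ = refl
R₀-involutive zero (_ ∷ []) _ = refl
R₀-involutive zero (X ∷ Y ∷ W) (vX ∷ vY ∷ _) = cong (λ (P , Q) → P ∷ Q ∷ W) (swapPair-involutive vX vY)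
R₀-involutive (suc k) [] _ = refl
R₀-involutive (suc k) (X ∷ W) (_ ∷ vW) = cong (X ∷_) (R₀-involutive k W vW)

R₀-product : (k : ℕ) (W : Vec (Step d) r) (z : Fin d) → prodSteps (R₀ k W) z ≡ prodSteps W z
R₀-product zero [] z = refl
R₀-product zero (_ ∷ []) z = refl
R₀-product zero (X ∷ Y ∷ W) z = swapPair-product X Y (prodSteps W z)
R₀-product (suc k) [] z = refl
R₀-product (suc k) (X ∷ W) z = cong (⟦ X ⟧ ⟨$⟩ʳ_) (R₀-product k W z)

R₀-walk : (k : ℕ) {ρ σ : Permutation′ d} (W : Vec (Step d) r) → IsWalk ρ σ W → IsWalk ρ σ (R₀ k W)
R₀-walk k {ρ} W (vW , σ≡ρW) = R₀-valid k W vW , λ z → trans (σ≡ρW z) (cong (ρ ⟨$⟩ʳ_) (sym (R₀-product k W z)))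

R₀-generators : (k : ℕ) (W : Vec (Step d) r) {G : List (Permutation′ d)} →
  (∀ {h} → h ∈ stepPerms (R₀ k W) → h ∈ G) → ∀ {h} → h ∈ stepPerms W → InSubgroup≈ G h
R₀-generators zero (X ∷ Y ∷ W) RW⊆G (here refl) =
  proj₁ (swapPair-generators X Y (gen (RW⊆G (here refl))) (gen (RW⊆G (there (here refl)))))
R₀-generators zero (X ∷ Y ∷ W) RW⊆G (there (here refl)) =
  proj₂ (swapPair-generators X Y (gen (RW⊆G (here refl))) (gen (RW⊆G (there (here refl)))))
R₀-generators zero (X ∷ Y ∷ W) RW⊆G (there (there h∈W)) = gen≈ (RW⊆G (there (there h∈W)))
R₀-generators zero (X ∷ []) RW⊆G h∈W = gen≈ (RW⊆G h∈W)
R₀-generators (suc k) (X ∷ W) RW⊆G (here refl) = gen≈ (RW⊆G (here refl))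
R₀-generators (suc k) (X ∷ W) RW⊆G (there h∈W) = R₀-generators k W (RW⊆G ∘ there) h∈W

R₀-transitive : (k : ℕ) {ρ σ : Permutation′ d} (W : Vec (Step d) r) → Transitive ρ σ W → Transitive ρ σ (R₀ k W)
R₀-transitive k {ρ} {σ} W transitive x y =
  let g , g∈⟨W⟩ , gx≡y = transitive x y
      g′ , g′∈⟨RW⟩ , g′≈g = InSubgroup≈-generated generators g∈⟨W⟩
  in g′ , g′∈⟨RW⟩ , trans (g′≈g x) gx≡y
  where
  generators : ∀ {h} → h ∈ ρ ∷ σ ∷ stepPerms W → InSubgroup≈ (ρ ∷ σ ∷ stepPerms (R₀ k W)) h
  generators (here refl) = gen≈ (here refl)
  generators (there (here refl)) = gen≈ (there (here refl))
  generators (there (there h∈W)) = R₀-generators k W (there ∘ there) h∈W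

R₀-comm : (k m : ℕ) (W : Vec (Step d) r) → k + 2 ≤ m → R₀ k (R₀ m W) ≡ R₀ m (R₀ k W)
R₀-comm zero (suc zero) W (s≤s ())
R₀-comm zero (suc (suc m)) [] _ = refl
R₀-comm zero (suc (suc m)) (_ ∷ []) _ = refl
R₀-comm zero (suc (suc m)) (_ ∷ _ ∷ _) _ = refl
R₀-comm (suc k) (suc m) [] _ = refl
R₀-comm (suc k) (suc m) (X ∷ W) (s≤s k+2≤m) = cong (X ∷_) (R₀-comm k m W k+2≤m)

R₀-zero : {X Y P Q : Step d} (W : Vec (Step d) r) → swapPair X Y ≡ (P , Q) → R₀ 0 (X ∷ Y ∷ W) ≡ P ∷ Q ∷ W
R₀-zero W = cong (λ (P , Q) → P ∷ Q ∷ W)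

braid-from-swaps : (A B C : Step d) {P₁ Q₁ P₂ Q₂ P₃ Q₃ P₁′ Q₁′ P₂′ Q₂′ P₃′ Q₃′ : Step d} (W : Vec (Step d) r) →
  swapPair A B ≡ (P₁ , Q₁) → swapPair Q₁ C ≡ (P₂ , Q₂) → swapPair P₁ P₂ ≡ (P₃ , Q₃) →
  swapPair B C ≡ (P₁′ , Q₁′) → swapPair A P₁′ ≡ (P₂′ , Q₂′) → swapPair Q₂′ Q₁′ ≡ (P₃′ , Q₃′) →
  P₃ ≡ P₂′ → Q₃ ≡ P₃′ → Q₂ ≡ Q₃′ →
  R₀ 0 (R₀ 1 (R₀ 0 (A ∷ B ∷ C ∷ W))) ≡ R₀ 1 (R₀ 0 (R₀ 1 (A ∷ B ∷ C ∷ W)))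
braid-from-swaps A B C {P₁} {Q₁} {P₂} {Q₂} {P₃} {Q₃} {P₁′} {Q₁′} {P₂′} {Q₂′} {P₃′} {Q₃′} W
  AB Q₁C P₁P₂ BC AP₁′ Q₂′Q₁′ refl refl refl = begin
  R₀ 0 (R₀ 1 (R₀ 0 (A ∷ B ∷ C ∷ W)))
    ≡⟨ cong (R₀ 0 ∘ R₀ 1) {R₀ 0 (A ∷ B ∷ C ∷ W)} {P₁ ∷ Q₁ ∷ C ∷ W} (R₀-zero (C ∷ W) AB) ⟩
  R₀ 0 (P₁ ∷ R₀ 0 (Q₁ ∷ C ∷ W))
    ≡⟨ cong (R₀ 0 ∘ (P₁ ∷_)) {R₀ 0 (Q₁ ∷ C ∷ W)} {P₂ ∷ Q₂ ∷ W} (R₀-zero W Q₁C) ⟩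
  R₀ 0 (P₁ ∷ P₂ ∷ Q₂ ∷ W)
    ≡⟨ R₀-zero (Q₂ ∷ W) P₁P₂ ⟩
  P₃ ∷ Q₃ ∷ Q₂ ∷ W
    ≡⟨ cong (P₃ ∷_) (R₀-zero W Q₂′Q₁′) ⟨
  P₃ ∷ R₀ 0 (Q₂′ ∷ Q₁′ ∷ W)
    ≡⟨ cong (R₀ 1) {R₀ 0 (A ∷ P₁′ ∷ Q₁′ ∷ W)} {P₃ ∷ Q₂′ ∷ Q₁′ ∷ W} (R₀-zero (Q₁′ ∷ W) AP₁′) ⟨
  R₀ 1 (R₀ 0 (A ∷ P₁′ ∷ Q₁′ ∷ W))
    ≡⟨ cong (R₀ 1 ∘ R₀ 0) {R₀ 1 (A ∷ B ∷ C ∷ W)} {A ∷ P₁′ ∷ Q₁′ ∷ W} (cong (A ∷_) (R₀-zero W BC)) ⟨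
  R₀ 1 (R₀ 0 (R₀ 1 (A ∷ B ∷ C ∷ W)))
    ∎
  where open ≡-Reasoning

-- The colours are compared through arguments rather than by with: abstracting a
-- comparison in this goal makes Agda normalise R₀, which is very slow. The comparison
-- of a with c is only consulted when the first two leave it open.
swapPair-braid : {a b c : Fin d} {A B C : Step d} (W : Vec (Step d) r) →
  Coloured a A → Coloured b B → Coloured c C →
  Tri (a < b) (a ≡ b) (b < a) → Tri (b < c) (b ≡ c) (c < b) → Tri (a < c) (a ≡ c) (c < a) →
  R₀ 0 (R₀ 1 (R₀ 0 (A ∷ B ∷ C ∷ W))) ≡ R₀ 1 (R₀ 0 (R₀ 1 (A ∷ B ∷ C ∷ W)))
swapPair-braid {A = A} {B} {C} W gA gB gC (tri< a<b _ _) (tri< b<c _ _) _ = braid-from-swaps A B C W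
  (swapPair-< gA gB a<b) (swapPair-< gA gC a<c) (swapPair-< (conj-coloured gA gB a<b) (conj-coloured gA gC a<c) b<c)
  (swapPair-< gB gC b<c) (swapPair-< gA (conj-coloured gB gC b<c) a<c) (swapPair-< gA gB a<b)
  (conj-selfDistrib A B C) refl refl
  where a<c = <-trans a<b b<c
swapPair-braid {A = A} {B} {C} W gA gB gC (tri< a<b _ _) (tri≈ _ refl _) _ = braid-from-swaps A B C W
  (swapPair-< gA gB a<b) (swapPair-< gA gC a<b) (swapPair-≡ (conj-coloured gA gB a<b) (conj-coloured gA gC a<b))
  (swapPair-≡ gB gC) (swapPair-< gA gB a<b) (swapPair-< gA gC a<b)
  refl refl refl
swapPair-braid {A = A} {B} {C} W gA gB gC (tri≈ _ refl _) (tri< b<c _ _) _ = braid-from-swaps A B C W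
  (swapPair-≡ gA gB) (swapPair-< gB gC b<c) (swapPair-< gA (conj-coloured gB gC b<c) b<c)
  (swapPair-< gB gC b<c) (swapPair-< gA (conj-coloured gB gC b<c) b<c) (swapPair-≡ gA gB)
  refl refl refl
swapPair-braid {A = A} {B} {C} W gA gB gC (tri≈ _ refl _) (tri≈ _ refl _) _ = braid-from-swaps A B C W
  (swapPair-≡ gA gB) (swapPair-≡ gB gC) (swapPair-≡ gA gB)
  (swapPair-≡ gB gC) (swapPair-≡ gA gB) (swapPair-≡ gB gC)
  refl refl refl
swapPair-braid {A = A} {B} {C} W gA gB gC (tri≈ _ refl _) (tri> _ _ c<b) _ = braid-from-swaps A B C W
  (swapPair-≡ gA gB) (swapPair-> gB gC c<b) (swapPair-> gA gC c<b)
  (swapPair-> gB gC c<b) (swapPair-> gA gC c<b) (swapPair-≡ (conj-coloured gC gA c<b) (conj-coloured gC gB c<b))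
  refl refl refl
swapPair-braid {A = A} {B} {C} W gA gB gC (tri> _ _ b<a) (tri≈ _ refl _) _ = braid-from-swaps A B C W
  (swapPair-> gA gB b<a) (swapPair-> (conj-coloured gB gA b<a) gC b<a) (swapPair-≡ gB gC)
  (swapPair-≡ gB gC) (swapPair-> gA gB b<a) (swapPair-> (conj-coloured gB gA b<a) gC b<a)
  refl refl refl
swapPair-braid {A = A} {B} {C} W gA gB gC (tri> _ _ b<a) (tri> _ _ c<b) _ = braid-from-swaps A B C W
  (swapPair-> gA gB b<a) (swapPair-> (conj-coloured gB gA b<a) gC c<a) (swapPair-> gB gC c<b)
  (swapPair-> gB gC c<b) (swapPair-> gA gC c<a) (swapPair-> (conj-coloured gC gA c<a) (conj-coloured gC gB c<b) b<a)
  refl refl (sym (conj-selfDistrib C B A))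
  where c<a = <-trans c<b b<a
swapPair-braid {A = A} {B} {C} W gA gB gC (tri< a<b _ _) (tri> _ _ c<b) (tri< a<c _ _) = braid-from-swaps A B C W
  (swapPair-< gA gB a<b) (swapPair-< gA gC a<c) (swapPair-> (conj-coloured gA gB a<b) (conj-coloured gA gC a<c) c<b)
  (swapPair-> gB gC c<b) (swapPair-< gA gC a<c) (swapPair-< gA (conj-coloured gC gB c<b) a<b)
  refl (conj-selfDistrib A C B) refl
swapPair-braid {A = A} {B} {C} W gA gB gC (tri< a<b _ _) (tri> _ _ c<b) (tri≈ _ refl _) = braid-from-swaps A B C W
  (swapPair-< gA gB a<b) (swapPair-≡ gA gC) (swapPair-> (conj-coloured gA gB a<b) gA a<b)
  (swapPair-> gB gC a<b) (swapPair-≡ gA gC) (swapPair-< gC (conj-coloured gC gB a<b) a<b)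
  refl (trans (conj-involutive A B (Coloured.valid gB)) (sym (conj-involutive C B (Coloured.valid gB)))) refl
swapPair-braid {A = A} {B} {C} W gA gB gC (tri< a<b _ _) (tri> _ _ c<b) (tri> _ _ c<a) = braid-from-swaps A B C W
  (swapPair-< gA gB a<b) (swapPair-> gA gC c<a) (swapPair-> (conj-coloured gA gB a<b) gC c<b)
  (swapPair-> gB gC c<b) (swapPair-> gA gC c<a) (swapPair-< (conj-coloured gC gA c<a) (conj-coloured gC gB c<b) a<b)
  refl (sym (conj-selfDistrib C A B)) refl
swapPair-braid {A = A} {B} {C} W gA gB gC (tri> _ _ b<a) (tri< b<c _ _) (tri< a<c _ _) = braid-from-swaps A B C W
  (swapPair-> gA gB b<a) (swapPair-< (conj-coloured gB gA b<a) gC a<c) (swapPair-< gB (conj-coloured (conj-coloured gB gA b<a) gC a<c) b<c)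
  (swapPair-< gB gC b<c) (swapPair-< gA (conj-coloured gB gC b<c) a<c) (swapPair-> gA gB b<a)
  (conj-twist B A C (Coloured.valid gC)) refl refl
swapPair-braid {A = A} {B} {C} W gA gB gC (tri> _ _ b<a) (tri< b<c _ _) (tri≈ _ refl _) = braid-from-swaps A B C W
  (swapPair-> gA gB b<a) (swapPair-≡ (conj-coloured gB gA b<a) gC) (swapPair-< gB (conj-coloured gB gA b<a) b<a)
  (swapPair-< gB gC b<a) (swapPair-≡ gA (conj-coloured gB gC b<a)) (swapPair-> (conj-coloured gB gC b<a) gB b<a)
  (conj-involutive B A (Coloured.valid gA)) refl (sym (conj-involutive B C (Coloured.valid gC)))
swapPair-braid {A = A} {B} {C} W gA gB gC (tri> _ _ b<a) (tri< b<c _ _) (tri> _ _ c<a) = braid-from-swaps A B C W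
  (swapPair-> gA gB b<a) (swapPair-> (conj-coloured gB gA b<a) gC c<a) (swapPair-< gB gC b<c)
  (swapPair-< gB gC b<c) (swapPair-> gA (conj-coloured gB gC b<c) c<a) (swapPair-> (conj-coloured (conj-coloured gB gC b<c) gA c<a) gB b<a)
  refl refl (sym (conj-twist B C A (Coloured.valid gA)))

R₀-braid : (k : ℕ) (W : Vec (Step d) r) → All ValidStep W → 3 + k ≤ r →
  R₀ k (R₀ (k + 1) (R₀ k W)) ≡ R₀ (k + 1) (R₀ k (R₀ (k + 1) W))
R₀-braid zero (_ ∷ []) _ (s≤s ())
R₀-braid zero (_ ∷ _ ∷ []) _ (s≤s (s≤s ()))
R₀-braid zero (A ∷ B ∷ C ∷ W) (vA ∷ vB ∷ vC ∷ _) _ =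
  swapPair-braid W (coloured vA refl) (coloured vB refl) (coloured vC refl) (<-cmp _ _) (<-cmp _ _) (<-cmp _ _)
R₀-braid (suc k) (X ∷ W) (_ ∷ vW) (s≤s 3+k≤r) = cong (X ∷_) (R₀-braid k W vW 3+k≤r)

proposition2p1 : (d r : ℕ) → 1 ≤ d → 2 ≤ r → (ρ σ : Permutation′ d) →
    ((i : ℕ) → 1 ≤ i → i ≤ r ∸ 1 → (W : Vec (Step d) r) → IsWalk ρ σ W →
      IsWalk ρ σ (R i W) × R i (R i W) ≡ W × (Transitive ρ σ W → Transitive ρ σ (R i W)))
    × ((i : ℕ) → 1 ≤ i → i ≤ r ∸ 2 → (W : Vec (Step d) r) → IsWalk ρ σ W →
      R i (R (i + 1) (R i W)) ≡ R (i + 1) (R i (R (i + 1) W)))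
    × ((i j : ℕ) → 1 ≤ i → i ≤ r ∸ 1 → 1 ≤ j → j ≤ r ∸ 1 → i + 2 ≤ j →
      (W : Vec (Step d) r) → IsWalk ρ σ W → R i (R j W) ≡ R j (R i W))
proposition2p1 d r _ 2≤r ρ σ =
    (λ { (suc k) _ _ W walk@(valid , _) →
           R₀-walk k {ρ} {σ} W walk , R₀-involutive k W valid , R₀-transitive k W })
  , (λ { (suc k) _ i≤r∸2 W (valid , _) →
           R₀-braid k W valid (subst (_≤ r) (+-comm (suc k) 2) (m≤o∸n⇒m+n≤o (suc k) 2≤r i≤r∸2)) })
  , (λ { (suc k) (suc m) _ _ _ _ (s≤s k+2≤m) W _ → R₀-comm k m W k+2≤m })
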